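{- For $P_l=A_l$ ($l\ge1$) and for $P_l=B_l$ ($l\ge2$), the polynomial $f_{P_l}(t)$ is divisible by $2t-1$ if and only if $l$ is odd.
   Context: Here $f_{A_l}(t)=\sum_{k=0}^l(-1)^k\frac{1}{l+2}\binom{l}{k}\binom{l+k+2}{k+1}t^k$ and $f_{B_l}(t)=\sum_{k=0}^l(-1)^k\binom lk\binom{l+k}{k}t^k$ (the $f$-polynomials of the cluster complexes of types $A_l$, $B_l$). -}

module Defs where

open import Data.Nat as ℕ using (ℕ; zero; suc)
open import Data.Nat.Combinatorics using (_C_)
open import Data.Integer as ℤ using (ℤ; +_)
open import Data.Rational as ℚ using (ℚ; _/_)
open import Data.List using (List; []; _∷_; map; upTo)
open import Data.Product using (∃)
open import Relation.Binary.PropositionalEquality using (_≡_)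

-- Univariate polynomials with rational coefficients, as coefficient lists
-- (constant term first).  Trailing zeros are allowed; equality of
-- polynomials is coefficientwise (see _≈ₚ_).
Poly : Set
Poly = List ℚ

coeff : Poly → ℕ → ℚ
coeff []       _       = ℚ.0ℚ
coeff (a ∷ p)  zero    = a
coeff (a ∷ p)  (suc k) = coeff p k

_+ₚ_ : Poly → Poly → Poly
[]      +ₚ q       = q
(a ∷ p) +ₚ []      = a ∷ p
(a ∷ p) +ₚ (b ∷ q) = (a ℚ.+ b) ∷ (p +ₚ q)

scale : ℚ → Poly → Poly
scale c p = map (c ℚ.*_) p

_*ₚ_ : Poly → Poly → Poly
[]      *ₚ q = []
(a ∷ p) *ₚ q = scale a q +ₚ (ℚ.0ℚ ∷ (p *ₚ q))

_≈ₚ_ : Poly → Poly → Set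
p ≈ₚ q = ∀ k → coeff p k ≡ coeff q k

_∣ₚ_ : Poly → Poly → Set
d ∣ₚ f = ∃ λ (q : Poly) → f ≈ₚ (d *ₚ q)

twoT-1 : Poly
twoT-1 = ℚ.- ℚ.1ℚ ∷ (+ 2 / 1) ∷ []

sgn : ℕ → ℤ
sgn zero    = + 1
sgn (suc k) = ℤ.- sgn k

fA : ℕ → Poly
fA l = map (λ k → (sgn k ℤ.* + ((l C k) ℕ.* ((l ℕ.+ k ℕ.+ 2) C (suc k)))) / suc (suc l))
           (upTo (suc l))

fB : ℕ → Poly
fB l = map (λ k → (sgn k ℤ.* + ((l C k) ℕ.* ((l ℕ.+ k) C k))) / 1)
           (upTo (suc l))

Odd : ℕ → Set
Odd l = ∃ λ m → l ≡ suc (2 ℕ.* m)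

-- 2t − 1 divides f exactly when f(½) = 0, by division with remainder.  Comparing
-- ratios of consecutive binomial coefficients gives the three-term recurrences
--   (l+2) f_{B_{l+2}} + (l+1) f_{B_l} = (2l+3)(1 − 2t) f_{B_{l+1}},
--   (l+2)(l+3) g_{l+2} + (l+1)(l+3) g_l = (2l+5)(l+2)(1 − 2t) g_{l+1},   g_l = (l+2) f_{A_l}.
-- At t = ½ the right-hand sides vanish while the coefficients on the left are
-- positive, so the value at ½ vanishes for l + 2 exactly when it vanishes for l.
-- It is nonzero for l = 0 and zero for l = 1, hence zero exactly for odd l.

module Submission where

open import Defs
open import Data.Nat using (ℕ; _≤_)
open import Data.Product using (_×_; _,_)
open import Function.Bundles using (_⇔_)

module CoefficientRecurrences where

  open import Data.Nat
  open import Data.Nat.Properties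
  open import Data.Nat.Combinatorics using (_C_; nCk+nC[k+1]≡[n+1]C[k+1]; nC1≡n; k>n⇒nCk≡0)
  open import Data.Nat.Tactic.RingSolver using (solve)
  open import Data.List using (_∷_; [])
  open import Data.Product using (∃; _,_)
  open import Data.Sum using (_⊎_; inj₁; inj₂)
  open import Relation.Binary.PropositionalEquality

  pascal : ∀ n k → n C k + n C suc k ≡ suc n C suc k
  pascal = nCk+nC[k+1]≡[n+1]C[k+1]

  C-absorption : ∀ n k → (suc n C suc k) * suc k ≡ (n C k) * suc n
  C-absorption zero    zero    = refl
  C-absorption zero    (suc k) = refl
  C-absorption (suc n) zero    =
    trans (*-identityʳ ((2 + n) C 1)) (trans (nC1≡n (2 + n)) (sym (*-identityˡ (2 + n))))
  C-absorption (suc n) (suc k) = begin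
    ((2 + n) C (2 + k)) * (2 + k)                       ≡⟨ cong (_* (2 + k)) (pascal (suc n) (suc k)) ⟨
    ((1 + n) C (1 + k) + (1 + n) C (2 + k)) * (2 + k)
      ≡⟨ step ((1 + n) C (1 + k)) ((1 + n) C (2 + k)) (n C k) (n C (1 + k))
              (sym (pascal n k)) (C-absorption n k) (C-absorption n (suc k)) ⟩
    (n C k + n C (1 + k)) * (2 + n)                     ≡⟨ cong (_* (2 + n)) (pascal n k) ⟩
    ((1 + n) C (1 + k)) * (2 + n)                       ∎
    where
    open ≡-Reasoning
    step : ∀ a b c d → a ≡ c + d → a * (1 + k) ≡ c * (1 + n) → b * (2 + k) ≡ d * (1 + n) →
           (a + b) * (2 + k) ≡ (c + d) * (2 + n)
    step a b c d a≡c+d p q = begin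
      (a + b) * (2 + k)                   ≡⟨ solve (a ∷ b ∷ k ∷ []) ⟩
      a * (1 + k) + a + b * (2 + k)       ≡⟨ cong₂ (λ x y → x + a + y) p q ⟩
      c * (1 + n) + a + d * (1 + n)       ≡⟨ cong (λ x → c * (1 + n) + x + d * (1 + n)) a≡c+d ⟩
      c * (1 + n) + (c + d) + d * (1 + n) ≡⟨ solve (n ∷ c ∷ d ∷ []) ⟩
      (c + d) * (2 + n)                   ∎

  C-succ-k : ∀ n k → (n C suc k) * suc k ≡ (n C k) * (n ∸ k)
  C-succ-k n k with ≤-total k n
  ... | inj₁ k≤n = +-cancelˡ-≡ ((n C k) * suc k) _ _ (begin
    (n C k) * suc k + (n C suc k) * suc k  ≡⟨ *-distribʳ-+ (suc k) (n C k) (n C suc k) ⟨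
    (n C k + n C suc k) * suc k            ≡⟨ cong (_* suc k) (pascal n k) ⟩
    (suc n C suc k) * suc k                ≡⟨ C-absorption n k ⟩
    (n C k) * suc n                        ≡⟨ cong (λ m → (n C k) * suc m) (m+[n∸m]≡n k≤n) ⟨
    (n C k) * (suc k + (n ∸ k))            ≡⟨ *-distribˡ-+ (n C k) (suc k) (n ∸ k) ⟩
    (n C k) * suc k + (n C k) * (n ∸ k)    ∎)
    where open ≡-Reasoning
  ... | inj₂ n≤k = begin
    (n C suc k) * suc k   ≡⟨ cong (_* suc k) (k>n⇒nCk≡0 (s≤s n≤k)) ⟩
    0                     ≡⟨ *-zeroʳ (n C k) ⟨
    (n C k) * 0           ≡⟨ cong ((n C k) *_) (m≤n⇒m∸n≡0 n≤k) ⟨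
    (n C k) * (n ∸ k)     ∎
    where open ≡-Reasoning

  C-succ-n : ∀ n k → (suc n C k) * (suc n ∸ k) ≡ (n C k) * suc n
  C-succ-n n zero    = refl
  C-succ-n n (suc k) = *-cancelʳ-≡ _ _ (suc k) (begin
    (suc n C suc k) * (n ∸ k) * suc k    ≡⟨ *-comm-middle (suc n C suc k) (n ∸ k) (suc k) ⟩
    (suc n C suc k) * suc k * (n ∸ k)    ≡⟨ cong (_* (n ∸ k)) (C-absorption n k) ⟩
    (n C k) * suc n * (n ∸ k)            ≡⟨ *-comm-middle (n C k) (suc n) (n ∸ k) ⟩
    (n C k) * (n ∸ k) * suc n            ≡⟨ cong (_* suc n) (C-succ-k n k) ⟨
    (n C suc k) * suc k * suc n          ≡⟨ *-comm-middle (n C suc k) (suc k) (suc n) ⟩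
    (n C suc k) * suc n * suc k          ∎)
    where
    open ≡-Reasoning
    *-comm-middle : ∀ a b c → a * b * c ≡ a * c * b
    *-comm-middle a b c = solve (a ∷ b ∷ c ∷ [])

  *-cross : ∀ a b c d {x y z w} → a * x ≡ b * y → c * z ≡ d * w → (a * c) * (x * z) ≡ (b * d) * (y * w)
  *-cross a b c d {x} {y} {z} {w} p q = begin
    (a * c) * (x * z)   ≡⟨ solve (a ∷ c ∷ x ∷ z ∷ []) ⟩
    (a * x) * (c * z)   ≡⟨ cong₂ _*_ p q ⟩
    (b * y) * (d * w)   ≡⟨ solve (b ∷ d ∷ y ∷ w ∷ []) ⟩
    (b * d) * (y * w)   ∎
    where open ≡-Reasoning

  -- fB l = Σₖ (−1)ᵏ bB l k tᵏ  and  (l + 2) · fA l = Σₖ (−1)ᵏ bA l k tᵏ.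
  bB : ℕ → ℕ → ℕ
  bB n k = (n C k) * ((n + k) C k)

  bA : ℕ → ℕ → ℕ
  bA n k = (n C k) * ((n + k + 2) C suc k)

  bB-succ-k : ∀ n k → bB n (suc k) * (suc k * suc k) ≡ bB n k * ((n ∸ k) * suc (n + k))
  bB-succ-k n k = *-cross (n C suc k) (n C k) ((n + suc k) C suc k) ((n + k) C k) (C-succ-k n k) second
    where
    second : ((n + suc k) C suc k) * suc k ≡ ((n + k) C k) * suc (n + k)
    second = subst (λ m → (m C suc k) * suc k ≡ ((n + k) C k) * suc (n + k))
                   (sym (+-suc n k)) (C-absorption (n + k) k)

  bB-succ-n : ∀ n k → bB (suc n) k * (suc n ∸ k) ≡ bB n k * suc (n + k)
  bB-succ-n n k = *-cancelʳ-≡ _ _ (suc n) (begin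
    bB (suc n) k * (suc n ∸ k) * suc n     ≡⟨ *-assoc (bB (suc n) k) (suc n ∸ k) (suc n) ⟩
    bB (suc n) k * ((suc n ∸ k) * suc n)
      ≡⟨ *-cross (suc n C k) (n C k) ((suc n + k) C k) ((n + k) C k) (C-succ-n n k) second ⟩
    bB n k * (suc n * suc (n + k))         ≡⟨ cong (bB n k *_) (*-comm (suc n) (suc (n + k))) ⟩
    bB n k * (suc (n + k) * suc n)         ≡⟨ *-assoc (bB n k) (suc (n + k)) (suc n) ⟨
    bB n k * suc (n + k) * suc n           ∎)
    where
    open ≡-Reasoning
    second : ((suc n + k) C k) * suc n ≡ ((n + k) C k) * suc (n + k)
    second = subst (λ m → ((suc n + k) C k) * m ≡ ((n + k) C k) * suc (n + k))
                   (m+n∸n≡m (suc n) k) (C-succ-n (n + k) k)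

  bA-succ-k : ∀ n k → bA n (suc k) * (suc k * suc (suc k)) ≡ bA n k * ((n ∸ k) * suc (n + k + 2))
  bA-succ-k n k =
    *-cross (n C suc k) (n C k) ((n + suc k + 2) C suc (suc k)) ((n + k + 2) C suc k) (C-succ-k n k) second
    where
    second : ((n + suc k + 2) C suc (suc k)) * suc (suc k) ≡ ((n + k + 2) C suc k) * suc (n + k + 2)
    second = subst (λ m → (m C suc (suc k)) * suc (suc k) ≡ ((n + k + 2) C suc k) * suc (n + k + 2))
                   (sym (cong (_+ 2) (+-suc n k))) (C-absorption (n + k + 2) (suc k))

  bA-succ-n : ∀ n k → bA (suc n) k * ((suc n ∸ k) * suc (suc n)) ≡ bA n k * (suc n * suc (n + k + 2))
  bA-succ-n n k = *-cross (suc n C k) (n C k) ((suc n + k + 2) C suc k) ((n + k + 2) C suc k) (C-succ-n n k) second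
    where
    n+k+2∸k : n + k + 2 ∸ k ≡ suc (suc n)
    n+k+2∸k = trans (cong (_∸ k) reorder) (m+n∸n≡m (suc (suc n)) k)
      where
      reorder : n + k + 2 ≡ suc (suc n) + k
      reorder = solve (n ∷ k ∷ [])
    second : ((suc n + k + 2) C suc k) * suc (suc n) ≡ ((n + k + 2) C suc k) * suc (n + k + 2)
    second = subst (λ m → ((suc n + k + 2) C suc k) * m ≡ ((n + k + 2) C suc k) * suc (n + k + 2))
                   n+k+2∸k (C-succ-n (n + k + 2) (suc k))

  bB-vanishes : ∀ {n k} → n < k → bB n k ≡ 0
  bB-vanishes {n} {k} n<k = cong (_* ((n + k) C k)) (k>n⇒nCk≡0 n<k)

  bA-vanishes : ∀ {n k} → n < k → bA n k ≡ 0
  bA-vanishes {n} {k} n<k = cong (_* ((n + k + 2) C suc k)) (k>n⇒nCk≡0 n<k)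

  bA-zero : ∀ n → bA n 0 ≡ 2 + n
  bA-zero n = trans (*-identityˡ ((n + 0 + 2) C 1)) (trans (nC1≡n (n + 0 + 2)) (solve (n ∷ [])))

  shift : (ℕ → ℕ) → ℕ → ℕ
  shift a zero    = 0
  shift a (suc k) = a k

  offset-or-excess : ∀ k m → (∃ λ j → m ≡ k + j) ⊎ (∃ λ d → k ≡ suc (d + m))
  offset-or-excess zero    m       = inj₁ (m , refl)
  offset-or-excess (suc k) zero    = inj₂ (k , cong suc (sym (+-identityʳ k)))
  offset-or-excess (suc k) (suc m) with offset-or-excess k m
  ... | inj₁ (j , m≡k+j)   = inj₁ (j , cong suc m≡k+j)
  ... | inj₂ (d , k≡1+d+m) = inj₂ (d , trans (cong suc k≡1+d+m) (cong suc (sym (+-suc d m))))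

  [1+k+j]∸k≡1+j : ∀ k j → suc (k + j) ∸ k ≡ suc j
  [1+k+j]∸k≡1+j k j = trans (cong (_∸ k) (sym (+-suc k j))) (m+n∸m≡n k (suc j))

  [1+n]∸n≡1 : ∀ n → suc n ∸ n ≡ 1
  [1+n]∸n≡1 n = trans (+-∸-assoc 1 (≤-refl {n})) (cong suc (n∸n≡0 n))

  B-Recurrence : ℕ → ℕ → Set
  B-Recurrence m k =
    (2 + m) * bB (2 + m) k + (1 + m) * bB m k ≡ (3 + 2 * m) * (bB (1 + m) k + 2 * shift (bB (1 + m)) k)

  -- At index k + 1 of the member m = k + j, the ratio lemmas express X₂, X₀ and Y
  -- through X₁ = bB (1 + m) (1 + k); multiplying by (j + 1)(2k + j + 2) clears denominators.
  B-recurrence-core : ∀ k j X₂ X₁ X₀ Y →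
    X₂ * suc j ≡ X₁ * suc (suc (k + j) + suc k) →
    X₁ * j ≡ X₀ * suc (k + j + suc k) →
    X₁ * (suc k * suc k) ≡ Y * (suc j * suc (suc (k + j) + k)) →
    (2 + (k + j)) * X₂ + (1 + (k + j)) * X₀ ≡ (3 + 2 * (k + j)) * (X₁ + 2 * Y)
  B-recurrence-core k j X₂ X₁ X₀ Y H₂ H₀ H′ = *-cancelʳ-≡ _ _ (suc j * suc (k + j + suc k)) (begin
    ((2 + (k + j)) * X₂ + (1 + (k + j)) * X₀) * (suc j * suc (k + j + suc k))
      ≡⟨ solve (k ∷ j ∷ X₂ ∷ X₀ ∷ []) ⟩
    (2 + (k + j)) * suc (k + j + suc k) * (X₂ * suc j) + (1 + (k + j)) * suc j * (X₀ * suc (k + j + suc k))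
      ≡⟨ cong₂ (λ a b → (2 + (k + j)) * suc (k + j + suc k) * a + (1 + (k + j)) * suc j * b) H₂ (sym H₀) ⟩
    (2 + (k + j)) * suc (k + j + suc k) * (X₁ * suc (suc (k + j) + suc k)) + (1 + (k + j)) * suc j * (X₁ * j)
      ≡⟨ solve (k ∷ j ∷ X₁ ∷ []) ⟩
    (3 + 2 * (k + j)) * (X₁ * (suc j * suc (k + j + suc k)) + 2 * (X₁ * (suc k * suc k)))
      ≡⟨ cong (λ a → (3 + 2 * (k + j)) * (X₁ * (suc j * suc (k + j + suc k)) + 2 * a)) H′ ⟩
    (3 + 2 * (k + j)) * (X₁ * (suc j * suc (k + j + suc k)) + 2 * (Y * (suc j * suc (suc (k + j) + k))))
      ≡⟨ solve (k ∷ j ∷ X₁ ∷ Y ∷ []) ⟩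
    (3 + 2 * (k + j)) * (X₁ + 2 * Y) * (suc j * suc (k + j + suc k)) ∎)
    where open ≡-Reasoning

  B-recurrence-inside : ∀ k j → B-Recurrence (k + j) (suc k)
  B-recurrence-inside k j =
    B-recurrence-core k j (bB (2 + m) (suc k)) (bB (1 + m) (suc k)) (bB m (suc k)) (bB (1 + m) k)
      (trans (cong (bB (2 + m) (suc k) *_) (sym ([1+k+j]∸k≡1+j k j))) (bB-succ-n (1 + m) (suc k)))
      (trans (cong (bB (1 + m) (suc k) *_) (sym (m+n∸m≡n k j))) (bB-succ-n m (suc k)))
      (trans (bB-succ-k (1 + m) k) (cong (λ x → bB (1 + m) k * (x * suc (suc m + k))) ([1+k+j]∸k≡1+j k j)))
    where m = k + j

  B-recurrence-edge-core : ∀ m X W Z →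
    X * ((2 + m) * (2 + m)) ≡ W * (1 * suc (suc (suc m) + suc m)) →
    W * 1 ≡ Z * suc (suc m + suc m) →
    (2 + m) * X + (1 + m) * 0 ≡ (3 + 2 * m) * (0 + 2 * Z)
  B-recurrence-edge-core m X W Z H H′ = *-cancelʳ-≡ _ _ (2 + m) (begin
    ((2 + m) * X + (1 + m) * 0) * (2 + m)                 ≡⟨ solve (m ∷ X ∷ []) ⟩
    X * ((2 + m) * (2 + m))                               ≡⟨ H ⟩
    W * (1 * suc (suc (suc m) + suc m))                   ≡⟨ *-assoc W 1 _ ⟨
    W * 1 * suc (suc (suc m) + suc m)                     ≡⟨ cong (_* suc (suc (suc m) + suc m)) H′ ⟩
    Z * suc (suc m + suc m) * suc (suc (suc m) + suc m)   ≡⟨ solve (m ∷ Z ∷ []) ⟩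
    (3 + 2 * m) * (0 + 2 * Z) * (2 + m)                   ∎)
    where open ≡-Reasoning

  B-recurrence-edge : ∀ m → B-Recurrence m (2 + m)
  B-recurrence-edge m
    rewrite bB-vanishes (m<n⇒m<1+n (n<1+n m)) | bB-vanishes (n<1+n (1 + m)) =
    B-recurrence-edge-core m (bB (2 + m) (2 + m)) (bB (2 + m) (1 + m)) (bB (1 + m) (1 + m))
      (trans (bB-succ-k (2 + m) (1 + m))
             (cong (λ x → bB (2 + m) (1 + m) * (x * suc (suc (suc m) + suc m))) ([1+n]∸n≡1 m)))
      (trans (cong (bB (2 + m) (1 + m) *_) (sym ([1+n]∸n≡1 m))) (bB-succ-n (1 + m) (1 + m)))

  B-recurrence-beyond : ∀ m d → B-Recurrence m (3 + d + m)
  B-recurrence-beyond m d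
    rewrite bB-vanishes {2 + m} {3 + d + m} (s≤s (s≤s (s≤s (m≤n+m m d))))
          | bB-vanishes {m}     {3 + d + m} (s≤s (m≤n+m m (2 + d)))
          | bB-vanishes {1 + m} {3 + d + m} (s≤s (s≤s (m≤n+m m (1 + d))))
          | bB-vanishes {1 + m} {2 + d + m} (s≤s (s≤s (m≤n+m m d))) = solve (m ∷ [])

  B-recurrence : ∀ m k → B-Recurrence m k
  B-recurrence m zero    = solve (m ∷ [])
  B-recurrence m (suc k) with offset-or-excess k m
  ... | inj₁ (j , refl)     = B-recurrence-inside k j
  ... | inj₂ (zero , refl)  = B-recurrence-edge m
  ... | inj₂ (suc d , refl) = B-recurrence-beyond m d

  A-Recurrence : ℕ → ℕ → Set
  A-Recurrence m k =
    (2 + m) * (3 + m) * bA (2 + m) k + (1 + m) * (3 + m) * bA m k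
      ≡ (5 + 2 * m) * (2 + m) * (bA (1 + m) k + 2 * shift (bA (1 + m)) k)

  A-recurrence-core : ∀ k j X₂ X₁ X₀ Y →
    X₂ * (suc j * (3 + (k + j))) ≡ X₁ * ((2 + (k + j)) * suc (suc (k + j) + suc k + 2)) →
    X₁ * (j * (2 + (k + j))) ≡ X₀ * ((1 + (k + j)) * suc (k + j + suc k + 2)) →
    X₁ * (suc k * suc (suc k)) ≡ Y * (suc j * suc (suc (k + j) + k + 2)) →
    (2 + (k + j)) * (3 + (k + j)) * X₂ + (1 + (k + j)) * (3 + (k + j)) * X₀
      ≡ (5 + 2 * (k + j)) * (2 + (k + j)) * (X₁ + 2 * Y)
  A-recurrence-core k j X₂ X₁ X₀ Y H₂ H₀ H′ =
    *-cancelʳ-≡ _ _ (suc j * (1 + (k + j)) * suc (k + j + suc k + 2)) (begin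
    ((2 + (k + j)) * (3 + (k + j)) * X₂ + (1 + (k + j)) * (3 + (k + j)) * X₀)
      * (suc j * (1 + (k + j)) * suc (k + j + suc k + 2))
      ≡⟨ solve (k ∷ j ∷ X₂ ∷ X₀ ∷ []) ⟩
    (2 + (k + j)) * (1 + (k + j)) * suc (k + j + suc k + 2) * (X₂ * (suc j * (3 + (k + j))))
      + (1 + (k + j)) * (3 + (k + j)) * suc j * (X₀ * ((1 + (k + j)) * suc (k + j + suc k + 2)))
      ≡⟨ cong₂ (λ a b → (2 + (k + j)) * (1 + (k + j)) * suc (k + j + suc k + 2) * a
                       + (1 + (k + j)) * (3 + (k + j)) * suc j * b) H₂ (sym H₀) ⟩
    (2 + (k + j)) * (1 + (k + j)) * suc (k + j + suc k + 2) * (X₁ * ((2 + (k + j)) * suc (suc (k + j) + suc k + 2)))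
      + (1 + (k + j)) * (3 + (k + j)) * suc j * (X₁ * (j * (2 + (k + j))))
      ≡⟨ solve (k ∷ j ∷ X₁ ∷ []) ⟩
    (5 + 2 * (k + j)) * (2 + (k + j))
      * (X₁ * (suc j * (1 + (k + j)) * suc (k + j + suc k + 2)) + 2 * ((1 + (k + j)) * (X₁ * (suc k * suc (suc k)))))
      ≡⟨ cong (λ a → (5 + 2 * (k + j)) * (2 + (k + j))
                     * (X₁ * (suc j * (1 + (k + j)) * suc (k + j + suc k + 2)) + 2 * ((1 + (k + j)) * a))) H′ ⟩
    (5 + 2 * (k + j)) * (2 + (k + j))
      * (X₁ * (suc j * (1 + (k + j)) * suc (k + j + suc k + 2)) + 2 * ((1 + (k + j)) * (Y * (suc j * suc (suc (k + j) + k + 2)))))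
      ≡⟨ solve (k ∷ j ∷ X₁ ∷ Y ∷ []) ⟩
    (5 + 2 * (k + j)) * (2 + (k + j)) * (X₁ + 2 * Y) * (suc j * (1 + (k + j)) * suc (k + j + suc k + 2)) ∎)
    where open ≡-Reasoning

  A-recurrence-inside : ∀ k j → A-Recurrence (k + j) (suc k)
  A-recurrence-inside k j =
    A-recurrence-core k j (bA (2 + m) (suc k)) (bA (1 + m) (suc k)) (bA m (suc k)) (bA (1 + m) k)
      (trans (cong (λ x → bA (2 + m) (suc k) * (x * (3 + m))) (sym ([1+k+j]∸k≡1+j k j))) (bA-succ-n (1 + m) (suc k)))
      (trans (cong (λ x → bA (1 + m) (suc k) * (x * (2 + m))) (sym (m+n∸m≡n k j))) (bA-succ-n m (suc k)))
      (trans (bA-succ-k (1 + m) k) (cong (λ x → bA (1 + m) k * (x * suc (suc m + k + 2))) ([1+k+j]∸k≡1+j k j)))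
    where m = k + j

  A-recurrence-edge-core : ∀ m X W Z →
    X * ((2 + m) * (3 + m)) ≡ W * (1 * suc (suc (suc m) + suc m + 2)) →
    W * (1 * (3 + m)) ≡ Z * ((2 + m) * suc (suc m + suc m + 2)) →
    (2 + m) * (3 + m) * X + (1 + m) * (3 + m) * 0 ≡ (5 + 2 * m) * (2 + m) * (0 + 2 * Z)
  A-recurrence-edge-core m X W Z H H′ = begin
    (2 + m) * (3 + m) * X + (1 + m) * (3 + m) * 0   ≡⟨ solve (m ∷ X ∷ []) ⟩
    X * ((2 + m) * (3 + m))                         ≡⟨ H ⟩
    W * (1 * suc (suc (suc m) + suc m + 2))         ≡⟨ solve (m ∷ W ∷ []) ⟩
    2 * (W * (1 * (3 + m)))                         ≡⟨ cong (2 *_) H′ ⟩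
    2 * (Z * ((2 + m) * suc (suc m + suc m + 2)))   ≡⟨ solve (m ∷ Z ∷ []) ⟩
    (5 + 2 * m) * (2 + m) * (0 + 2 * Z)             ∎
    where open ≡-Reasoning

  A-recurrence-edge : ∀ m → A-Recurrence m (2 + m)
  A-recurrence-edge m
    rewrite bA-vanishes (m<n⇒m<1+n (n<1+n m)) | bA-vanishes (n<1+n (1 + m)) =
    A-recurrence-edge-core m (bA (2 + m) (2 + m)) (bA (2 + m) (1 + m)) (bA (1 + m) (1 + m))
      (trans (bA-succ-k (2 + m) (1 + m))
             (cong (λ x → bA (2 + m) (1 + m) * (x * suc (suc (suc m) + suc m + 2))) ([1+n]∸n≡1 m)))
      (trans (cong (λ x → bA (2 + m) (1 + m) * (x * (3 + m))) (sym ([1+n]∸n≡1 m))) (bA-succ-n (1 + m) (1 + m)))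

  A-recurrence-beyond : ∀ m d → A-Recurrence m (3 + d + m)
  A-recurrence-beyond m d
    rewrite bA-vanishes {2 + m} {3 + d + m} (s≤s (s≤s (s≤s (m≤n+m m d))))
          | bA-vanishes {m}     {3 + d + m} (s≤s (m≤n+m m (2 + d)))
          | bA-vanishes {1 + m} {3 + d + m} (s≤s (s≤s (m≤n+m m (1 + d))))
          | bA-vanishes {1 + m} {2 + d + m} (s≤s (s≤s (m≤n+m m d))) = solve (m ∷ [])

  A-recurrence : ∀ m k → A-Recurrence m k
  A-recurrence m zero
    rewrite bA-zero (2 + m) | bA-zero m | bA-zero (1 + m) = solve (m ∷ [])
  A-recurrence m (suc k) with offset-or-excess k m
  ... | inj₁ (j , refl)     = A-recurrence-inside k j
  ... | inj₂ (zero , refl)  = A-recurrence-edge m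
  ... | inj₂ (suc d , refl) = A-recurrence-beyond m d

module RationalPolynomials where

  open import Data.Nat as ℕ using (ℕ; zero; suc)
  open import Data.Integer as ℤ using (ℤ; +_)
  import Data.Integer.Properties as ℤ
  open import Data.Integer.Tactic.RingSolver using (solve-∀)
  open import Data.Rational using (ℚ; _+_; _*_; -_; 0ℚ; 1ℚ; ½; _/_; toℚᵘ; NonZero; Positive; 1/_)
  import Data.Rational.Properties as ℚ
  import Data.Rational.Unnormalised as ℚᵘ
  import Data.Rational.Unnormalised.Properties as ℚᵘ
  open import Data.Rational.Solver using (module +-*-Solver)
  open +-*-Solver using (solve; _:+_; _:*_; _:=_; con)
  open import Data.List using ([]; _∷_; map; applyUpTo)
  open import Data.Product using (_,_)
  open import Function.Bundles using (_⇔_; mk⇔; Equivalence)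
  open import Relation.Binary.PropositionalEquality
  open CoefficientRecurrences using (shift)

  ι : ℤ → ℚ
  ι z = z / 1

  private
    toℚᵘ-ι : ∀ z → toℚᵘ (ι z) ℚᵘ.≃ ℚᵘ.mkℚᵘ z 0
    toℚᵘ-ι z = ℚ.toℚᵘ-fromℚᵘ (ℚᵘ.mkℚᵘ z 0)

  ι-+ : ∀ a b → ι a + ι b ≡ ι (a ℤ.+ b)
  ι-+ a b = ℚ.toℚᵘ-injective (ℚᵘ.≃-trans (ℚ.toℚᵘ-homo-+ (ι a) (ι b))
    (ℚᵘ.≃-trans (ℚᵘ.+-cong (toℚᵘ-ι a) (toℚᵘ-ι b))
    (ℚᵘ.≃-trans (ℚᵘ.*≡* (cross a b)) (ℚᵘ.≃-sym (toℚᵘ-ι (a ℤ.+ b))))))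
    where
    cross : ∀ a b → (a ℤ.* + 1 ℤ.+ b ℤ.* + 1) ℤ.* + 1 ≡ (a ℤ.+ b) ℤ.* (+ 1 ℤ.* + 1)
    cross = solve-∀

  ι-* : ∀ a b → ι a * ι b ≡ ι (a ℤ.* b)
  ι-* a b = ℚ.toℚᵘ-injective (ℚᵘ.≃-trans (ℚ.toℚᵘ-homo-* (ι a) (ι b))
    (ℚᵘ.≃-trans (ℚᵘ.*-cong (toℚᵘ-ι a) (toℚᵘ-ι b))
    (ℚᵘ.≃-trans (ℚᵘ.*≡* (cross a b)) (ℚᵘ.≃-sym (toℚᵘ-ι (a ℤ.* b))))))
    where
    cross : ∀ a b → (a ℤ.* b) ℤ.* + 1 ≡ (a ℤ.* b) ℤ.* (+ 1 ℤ.* + 1)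
    cross = solve-∀

  ι-linear : ∀ a x b y → ι a * ι x + ι b * ι y ≡ ι (a ℤ.* x ℤ.+ b ℤ.* y)
  ι-linear a x b y = trans (cong₂ _+_ (ι-* a x) (ι-* b y)) (ι-+ (a ℤ.* x) (b ℤ.* y))

  ι-*-/ : ∀ n z → ι (+ suc n) * (z / suc n) ≡ ι z
  ι-*-/ n z = ℚ.toℚᵘ-injective (ℚᵘ.≃-trans (ℚ.toℚᵘ-homo-* (ι (+ suc n)) (z / suc n))
    (ℚᵘ.≃-trans (ℚᵘ.*-cong (toℚᵘ-ι (+ suc n)) (ℚ.toℚᵘ-fromℚᵘ (ℚᵘ.mkℚᵘ z n)))
    (ℚᵘ.≃-trans (ℚᵘ.*≡* (cross (+ suc n) z)) (ℚᵘ.≃-sym (toℚᵘ-ι z)))))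
    where
    cross : ∀ m z → (m ℤ.* z) ℤ.* + 1 ≡ z ℤ.* (+ 1 ℤ.* m)
    cross = solve-∀

  ι*≡0⇔≡0 : ∀ n .{{_ : ℕ.NonZero n}} x → ι (+ n) * x ≡ 0ℚ ⇔ x ≡ 0ℚ
  ι*≡0⇔≡0 n x = mk⇔ cancel λ { refl → ℚ.*-zeroʳ (ι (+ n)) }
    where
    open ≡-Reasoning
    c = ι (+ n)
    instance
      c-positive : Positive c
      c-positive = ℚ.normalize-pos n 1
      c-nonZero : NonZero c
      c-nonZero = ℚ.pos⇒nonZero c
    cancel : c * x ≡ 0ℚ → x ≡ 0ℚ
    cancel cx≡0 = begin
      x                 ≡⟨ ℚ.*-identityˡ x ⟨
      1ℚ * x            ≡⟨ cong (_* x) (ℚ.*-inverseˡ c) ⟨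
      (1/ c) * c * x    ≡⟨ ℚ.*-assoc (1/ c) c x ⟩
      (1/ c) * (c * x)  ≡⟨ cong ((1/ c) *_) cx≡0 ⟩
      (1/ c) * 0ℚ       ≡⟨ ℚ.*-zeroʳ (1/ c) ⟩
      0ℚ                ∎

  positive-combination-zeros : ∀ m n .{{_ : ℕ.NonZero m}} .{{_ : ℕ.NonZero n}} x y →
    ι (+ m) * x + ι (+ n) * y ≡ 0ℚ → x ≡ 0ℚ ⇔ y ≡ 0ℚ
  positive-combination-zeros m n x y h = mk⇔
    (λ x≡0 → Equivalence.to (ι*≡0⇔≡0 n y) (trans (sym (drop-first x≡0)) h))
    (λ y≡0 → Equivalence.to (ι*≡0⇔≡0 m x) (trans (sym (drop-second y≡0)) h))
    where
    drop-first : x ≡ 0ℚ → ι (+ m) * x + ι (+ n) * y ≡ ι (+ n) * y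
    drop-first refl = trans (cong (_+ ι (+ n) * y) (ℚ.*-zeroʳ (ι (+ m)))) (ℚ.+-identityˡ _)
    drop-second : y ≡ 0ℚ → ι (+ m) * x + ι (+ n) * y ≡ ι (+ m) * x
    drop-second refl = trans (cong (_+_ (ι (+ m) * x)) (ℚ.*-zeroʳ (ι (+ n)))) (ℚ.+-identityʳ _)

  coeff-+ₚ : ∀ p q k → coeff (p +ₚ q) k ≡ coeff p k + coeff q k
  coeff-+ₚ []      q       k       = sym (ℚ.+-identityˡ (coeff q k))
  coeff-+ₚ (a ∷ p) []      k       = sym (ℚ.+-identityʳ (coeff (a ∷ p) k))
  coeff-+ₚ (a ∷ p) (b ∷ q) zero    = refl
  coeff-+ₚ (a ∷ p) (b ∷ q) (suc k) = coeff-+ₚ p q k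

  coeff-scale : ∀ c p k → coeff (scale c p) k ≡ c * coeff p k
  coeff-scale c []      k       = sym (ℚ.*-zeroʳ c)
  coeff-scale c (a ∷ p) zero    = refl
  coeff-scale c (a ∷ p) (suc k) = coeff-scale c p k

  coeff-map-applyUpTo : ∀ (g : ℕ → ℚ) f n → (∀ k → n ℕ.≤ k → g (f k) ≡ 0ℚ) →
    ∀ k → coeff (map g (applyUpTo f n)) k ≡ g (f k)
  coeff-map-applyUpTo g f zero    vanish k       = sym (vanish k ℕ.z≤n)
  coeff-map-applyUpTo g f (suc n) vanish zero    = refl
  coeff-map-applyUpTo g f (suc n) vanish (suc k) =
    coeff-map-applyUpTo g (λ i → f (suc i)) n (λ i n≤i → vanish (suc i) (ℕ.s≤s n≤i)) k

  coeff-twoT-1*-zero : ∀ q → coeff (twoT-1 *ₚ q) zero ≡ - 1ℚ * coeff q zero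
  coeff-twoT-1*-zero q = begin
    coeff (scale (- 1ℚ) q +ₚ (0ℚ ∷ _)) zero   ≡⟨ coeff-+ₚ (scale (- 1ℚ) q) _ zero ⟩
    coeff (scale (- 1ℚ) q) zero + 0ℚ          ≡⟨ ℚ.+-identityʳ _ ⟩
    coeff (scale (- 1ℚ) q) zero               ≡⟨ coeff-scale (- 1ℚ) q zero ⟩
    - 1ℚ * coeff q zero                       ∎
    where open ≡-Reasoning

  coeff-twoT-1*-suc : ∀ q k → coeff (twoT-1 *ₚ q) (suc k) ≡ - 1ℚ * coeff q (suc k) + ι (+ 2) * coeff q k
  coeff-twoT-1*-suc q k = begin
    coeff (scale (- 1ℚ) q +ₚ (0ℚ ∷ (scale (ι (+ 2)) q +ₚ (0ℚ ∷ [])))) (suc k)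
      ≡⟨ coeff-+ₚ (scale (- 1ℚ) q) _ (suc k) ⟩
    coeff (scale (- 1ℚ) q) (suc k) + coeff (scale (ι (+ 2)) q +ₚ (0ℚ ∷ [])) k
      ≡⟨ cong₂ _+_ (coeff-scale (- 1ℚ) q (suc k)) (coeff-+ₚ (scale (ι (+ 2)) q) _ k) ⟩
    - 1ℚ * coeff q (suc k) + (coeff (scale (ι (+ 2)) q) k + coeff (0ℚ ∷ []) k)
      ≡⟨ cong₂ (λ a b → - 1ℚ * coeff q (suc k) + (a + b)) (coeff-scale (ι (+ 2)) q k) (coeff-0 k) ⟩
    - 1ℚ * coeff q (suc k) + (ι (+ 2) * coeff q k + 0ℚ)
      ≡⟨ cong (_+_ (- 1ℚ * coeff q (suc k))) (ℚ.+-identityʳ _) ⟩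
    - 1ℚ * coeff q (suc k) + ι (+ 2) * coeff q k ∎
    where
    open ≡-Reasoning
    coeff-0 : ∀ k → coeff (0ℚ ∷ []) k ≡ 0ℚ
    coeff-0 zero    = refl
    coeff-0 (suc k) = refl

  ev½ : Poly → ℚ
  ev½ []      = 0ℚ
  ev½ (a ∷ p) = a + ½ * ev½ p

  ev½-+ₚ : ∀ p q → ev½ (p +ₚ q) ≡ ev½ p + ev½ q
  ev½-+ₚ []      q       = sym (ℚ.+-identityˡ (ev½ q))
  ev½-+ₚ (a ∷ p) []      = sym (ℚ.+-identityʳ (ev½ (a ∷ p)))
  ev½-+ₚ (a ∷ p) (b ∷ q) = trans (cong (λ x → (a + b) + ½ * x) (ev½-+ₚ p q))
    (solve 4 (λ a b x y → (a :+ b) :+ con ½ :* (x :+ y) := (a :+ con ½ :* x) :+ (b :+ con ½ :* y))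
           refl a b (ev½ p) (ev½ q))

  ev½-scale : ∀ c p → ev½ (scale c p) ≡ c * ev½ p
  ev½-scale c []      = sym (ℚ.*-zeroʳ c)
  ev½-scale c (a ∷ p) = trans (cong (λ x → c * a + ½ * x) (ev½-scale c p))
    (solve 3 (λ c a x → c :* a :+ con ½ :* (c :* x) := c :* (a :+ con ½ :* x)) refl c a (ev½ p))

  ev½-cong : ∀ p q → p ≈ₚ q → ev½ p ≡ ev½ q
  ev½-cong []      []      p≈q = refl
  ev½-cong []      (b ∷ q) p≈q = cong₂ (λ x y → x + ½ * y) (p≈q zero) (ev½-cong [] q (λ k → p≈q (suc k)))
  ev½-cong (a ∷ p) []      p≈q = cong₂ (λ x y → x + ½ * y) (p≈q zero) (ev½-cong p [] (λ k → p≈q (suc k)))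
  ev½-cong (a ∷ p) (b ∷ q) p≈q = cong₂ (λ x y → x + ½ * y) (p≈q zero) (ev½-cong p q (λ k → p≈q (suc k)))

  ev½-twoT-1* : ∀ q → ev½ (twoT-1 *ₚ q) ≡ 0ℚ
  ev½-twoT-1* q = begin
    ev½ (scale (- 1ℚ) q +ₚ (0ℚ ∷ (scale (ι (+ 2)) q +ₚ (0ℚ ∷ []))))
      ≡⟨ ev½-+ₚ (scale (- 1ℚ) q) _ ⟩
    ev½ (scale (- 1ℚ) q) + (0ℚ + ½ * ev½ (scale (ι (+ 2)) q +ₚ (0ℚ ∷ [])))
      ≡⟨ cong₂ (λ a b → a + (0ℚ + ½ * b)) (ev½-scale (- 1ℚ) q) (ev½-+ₚ (scale (ι (+ 2)) q) _) ⟩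
    - 1ℚ * ev½ q + (0ℚ + ½ * (ev½ (scale (ι (+ 2)) q) + (0ℚ + ½ * 0ℚ)))
      ≡⟨ cong (λ b → - 1ℚ * ev½ q + (0ℚ + ½ * (b + (0ℚ + ½ * 0ℚ)))) (ev½-scale (ι (+ 2)) q) ⟩
    - 1ℚ * ev½ q + (0ℚ + ½ * (ι (+ 2) * ev½ q + (0ℚ + ½ * 0ℚ)))
      ≡⟨ solve 1 (λ x → con (- 1ℚ) :* x :+ (con 0ℚ :+ con ½ :* (con (ι (+ 2)) :* x :+ (con 0ℚ :+ con ½ :* con 0ℚ)))
                        := con 0ℚ) refl (ev½ q) ⟩
    0ℚ ∎
    where open ≡-Reasoning

  quotient : Poly → Poly
  quotient []      = []
  quotient (a ∷ p) = ½ * ev½ p ∷ quotient p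

  division-zero : ∀ f → coeff f zero ≡ coeff (twoT-1 *ₚ quotient f) zero + ev½ f
  division-zero []      = refl
  division-zero (a ∷ p) = begin
    a
      ≡⟨ solve 2 (λ a x → a := con (- 1ℚ) :* (con ½ :* x) :+ (a :+ con ½ :* x)) refl a (ev½ p) ⟩
    - 1ℚ * (½ * ev½ p) + ev½ (a ∷ p)
      ≡⟨ cong (_+ ev½ (a ∷ p)) (coeff-twoT-1*-zero (quotient (a ∷ p))) ⟨
    coeff (twoT-1 *ₚ quotient (a ∷ p)) zero + ev½ (a ∷ p) ∎
    where open ≡-Reasoning

  division-suc : ∀ f k → coeff f (suc k) ≡ coeff (twoT-1 *ₚ quotient f) (suc k)
  division-suc []      k       = sym (coeff-twoT-1*-suc [] k)
  division-suc (a ∷ p) zero    = begin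
    coeff p zero                                             ≡⟨ division-zero p ⟩
    coeff (twoT-1 *ₚ quotient p) zero + ev½ p                ≡⟨ cong (_+ ev½ p) (coeff-twoT-1*-zero (quotient p)) ⟩
    - 1ℚ * coeff (quotient p) zero + ev½ p
      ≡⟨ solve 2 (λ x e → con (- 1ℚ) :* x :+ e := con (- 1ℚ) :* x :+ con (ι (+ 2)) :* (con ½ :* e))
               refl (coeff (quotient p) zero) (ev½ p) ⟩
    - 1ℚ * coeff (quotient p) zero + ι (+ 2) * (½ * ev½ p)   ≡⟨ coeff-twoT-1*-suc (quotient (a ∷ p)) zero ⟨
    coeff (twoT-1 *ₚ quotient (a ∷ p)) 1                     ∎
    where open ≡-Reasoning
  division-suc (a ∷ p) (suc k) = begin
    coeff p (suc k)                                                    ≡⟨ division-suc p k ⟩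
    coeff (twoT-1 *ₚ quotient p) (suc k)                               ≡⟨ coeff-twoT-1*-suc (quotient p) k ⟩
    - 1ℚ * coeff (quotient p) (suc k) + ι (+ 2) * coeff (quotient p) k ≡⟨ coeff-twoT-1*-suc (quotient (a ∷ p)) (suc k) ⟨
    coeff (twoT-1 *ₚ quotient (a ∷ p)) (suc (suc k))                   ∎
    where open ≡-Reasoning

  twoT-1∣⇔ev½≡0 : ∀ f → twoT-1 ∣ₚ f ⇔ ev½ f ≡ 0ℚ
  twoT-1∣⇔ev½≡0 f = mk⇔
    (λ (q , f≈[2t-1]q) → trans (ev½-cong f (twoT-1 *ₚ q) f≈[2t-1]q) (ev½-twoT-1* q))
    (λ ev½≡0 → quotient f , divides ev½≡0)
    where
    divides : ev½ f ≡ 0ℚ → f ≈ₚ (twoT-1 *ₚ quotient f)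
    divides ev½≡0 zero    = trans (division-zero f)
      (trans (cong (_+_ (coeff (twoT-1 *ₚ quotient f) zero)) ev½≡0) (ℚ.+-identityʳ _))
    divides ev½≡0 (suc k) = division-suc f k

  ev½-recurrence : ∀ c₂ c₀ c p₂ p₀ p₁ → (scale c₂ p₂ +ₚ scale c₀ p₀) ≈ₚ scale c (twoT-1 *ₚ p₁) →
    c₂ * ev½ p₂ + c₀ * ev½ p₀ ≡ 0ℚ
  ev½-recurrence c₂ c₀ c p₂ p₀ p₁ rec = begin
    c₂ * ev½ p₂ + c₀ * ev½ p₀                  ≡⟨ cong₂ _+_ (ev½-scale c₂ p₂) (ev½-scale c₀ p₀) ⟨
    ev½ (scale c₂ p₂) + ev½ (scale c₀ p₀)      ≡⟨ ev½-+ₚ (scale c₂ p₂) (scale c₀ p₀) ⟨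
    ev½ (scale c₂ p₂ +ₚ scale c₀ p₀)           ≡⟨ ev½-cong (scale c₂ p₂ +ₚ scale c₀ p₀) (scale c (twoT-1 *ₚ p₁)) rec ⟩
    ev½ (scale c (twoT-1 *ₚ p₁))               ≡⟨ ev½-scale c (twoT-1 *ₚ p₁) ⟩
    c * ev½ (twoT-1 *ₚ p₁)                     ≡⟨ cong (c *_) (ev½-twoT-1* p₁) ⟩
    c * 0ℚ                                     ≡⟨ ℚ.*-zeroʳ c ⟩
    0ℚ                                         ∎
    where open ≡-Reasoning

  _HasCoeffs_ : Poly → (ℕ → ℤ) → Set
  p HasCoeffs z = ∀ k → coeff p k ≡ ι (z k)

  alternating : (ℕ → ℕ) → ℕ → ℤ
  alternating a k = sgn k ℤ.* + a k

  signed-identity : ∀ s c₂ a₂ c₀ a₀ c b → c₂ ℕ.* a₂ ℕ.+ c₀ ℕ.* a₀ ≡ c ℕ.* b →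
    + c₂ ℤ.* (s ℤ.* + a₂) ℤ.+ + c₀ ℤ.* (s ℤ.* + a₀) ≡ s ℤ.* (+ c ℤ.* + b)
  signed-identity s c₂ a₂ c₀ a₀ c b eq = begin
    + c₂ ℤ.* (s ℤ.* + a₂) ℤ.+ + c₀ ℤ.* (s ℤ.* + a₀)   ≡⟨ factor-sign s (+ c₂) (+ a₂) (+ c₀) (+ a₀) ⟩
    s ℤ.* (+ c₂ ℤ.* + a₂ ℤ.+ + c₀ ℤ.* + a₀)           ≡⟨ cong (s ℤ.*_) (cong₂ ℤ._+_ (ℤ.pos-* c₂ a₂) (ℤ.pos-* c₀ a₀)) ⟨
    s ℤ.* (+ (c₂ ℕ.* a₂) ℤ.+ + (c₀ ℕ.* a₀))           ≡⟨ cong (s ℤ.*_) (ℤ.pos-+ (c₂ ℕ.* a₂) (c₀ ℕ.* a₀)) ⟨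
    s ℤ.* + (c₂ ℕ.* a₂ ℕ.+ c₀ ℕ.* a₀)                 ≡⟨ cong (λ x → s ℤ.* + x) eq ⟩
    s ℤ.* + (c ℕ.* b)                                 ≡⟨ cong (s ℤ.*_) (ℤ.pos-* c b) ⟩
    s ℤ.* (+ c ℤ.* + b)                               ∎
    where
    open ≡-Reasoning
    factor-sign : ∀ s c₂ a₂ c₀ a₀ → c₂ ℤ.* (s ℤ.* a₂) ℤ.+ c₀ ℤ.* (s ℤ.* a₀) ≡ s ℤ.* (c₂ ℤ.* a₂ ℤ.+ c₀ ℤ.* a₀)
    factor-sign = solve-∀

  alternating-recurrence : ∀ (c₂ c₀ c : ℕ) (p₂ p₀ p₁ : Poly) {a₂ a₀ a₁ : ℕ → ℕ} →
    p₂ HasCoeffs alternating a₂ → p₀ HasCoeffs alternating a₀ → p₁ HasCoeffs alternating a₁ →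
    (∀ k → c₂ ℕ.* a₂ k ℕ.+ c₀ ℕ.* a₀ k ≡ c ℕ.* (a₁ k ℕ.+ 2 ℕ.* shift a₁ k)) →
    (scale (ι (+ c₂)) p₂ +ₚ scale (ι (+ c₀)) p₀) ≈ₚ scale (ι (ℤ.- + c)) (twoT-1 *ₚ p₁)
  alternating-recurrence c₂ c₀ c p₂ p₀ p₁ {a₂} {a₀} {a₁} h₂ h₀ h₁ rec k = begin
    coeff (scale (ι (+ c₂)) p₂ +ₚ scale (ι (+ c₀)) p₀) k
      ≡⟨ coeff-+ₚ (scale (ι (+ c₂)) p₂) (scale (ι (+ c₀)) p₀) k ⟩
    coeff (scale (ι (+ c₂)) p₂) k + coeff (scale (ι (+ c₀)) p₀) k
      ≡⟨ cong₂ _+_ (coeff-scale (ι (+ c₂)) p₂ k) (coeff-scale (ι (+ c₀)) p₀ k) ⟩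
    ι (+ c₂) * coeff p₂ k + ι (+ c₀) * coeff p₀ k
      ≡⟨ cong₂ (λ x y → ι (+ c₂) * x + ι (+ c₀) * y) (h₂ k) (h₀ k) ⟩
    ι (+ c₂) * ι (alternating a₂ k) + ι (+ c₀) * ι (alternating a₀ k)
      ≡⟨ ι-linear (+ c₂) (alternating a₂ k) (+ c₀) (alternating a₀ k) ⟩
    ι (+ c₂ ℤ.* alternating a₂ k ℤ.+ + c₀ ℤ.* alternating a₀ k)
      ≡⟨ cong ι (signed-identity (sgn k) c₂ (a₂ k) c₀ (a₀ k) c (a₁ k ℕ.+ 2 ℕ.* shift a₁ k) (rec k)) ⟩
    ι (sgn k ℤ.* (+ c ℤ.* + (a₁ k ℕ.+ 2 ℕ.* shift a₁ k)))
      ≡⟨ rhs k ⟨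
    coeff (scale (ι (ℤ.- + c)) (twoT-1 *ₚ p₁)) k ∎
    where
    open ≡-Reasoning
    cast : ∀ a b → + (a ℕ.+ 2 ℕ.* b) ≡ + a ℤ.+ + 2 ℤ.* + b
    cast a b = trans (ℤ.pos-+ a (2 ℕ.* b)) (cong (ℤ._+_ (+ a)) (ℤ.pos-* 2 b))
    rhs : ∀ k → coeff (scale (ι (ℤ.- + c)) (twoT-1 *ₚ p₁)) k ≡ ι (sgn k ℤ.* (+ c ℤ.* + (a₁ k ℕ.+ 2 ℕ.* shift a₁ k)))
    rhs zero = begin
      coeff (scale (ι (ℤ.- + c)) (twoT-1 *ₚ p₁)) zero
        ≡⟨ coeff-scale (ι (ℤ.- + c)) (twoT-1 *ₚ p₁) zero ⟩
      ι (ℤ.- + c) * coeff (twoT-1 *ₚ p₁) zero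
        ≡⟨ cong (ι (ℤ.- + c) *_) (coeff-twoT-1*-zero p₁) ⟩
      ι (ℤ.- + c) * (ι (ℤ.- + 1) * coeff p₁ zero)
        ≡⟨ cong (λ x → ι (ℤ.- + c) * (ι (ℤ.- + 1) * x)) (h₁ zero) ⟩
      ι (ℤ.- + c) * (ι (ℤ.- + 1) * ι (alternating a₁ zero))
        ≡⟨ trans (cong (ι (ℤ.- + c) *_) (ι-* (ℤ.- + 1) (alternating a₁ zero))) (ι-* (ℤ.- + c) _) ⟩
      ι (ℤ.- + c ℤ.* (ℤ.- + 1 ℤ.* (+ 1 ℤ.* + a₁ zero)))
        ≡⟨ cong ι (rearrange (+ c) (+ a₁ zero)) ⟩
      ι (+ 1 ℤ.* (+ c ℤ.* (+ a₁ zero ℤ.+ + 2 ℤ.* + 0)))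
        ≡⟨ cong (λ x → ι (+ 1 ℤ.* (+ c ℤ.* x))) (cast (a₁ zero) 0) ⟨
      ι (+ 1 ℤ.* (+ c ℤ.* + (a₁ zero ℕ.+ 2 ℕ.* 0))) ∎
      where
      rearrange : ∀ c a → ℤ.- c ℤ.* (ℤ.- + 1 ℤ.* (+ 1 ℤ.* a)) ≡ + 1 ℤ.* (c ℤ.* (a ℤ.+ + 2 ℤ.* + 0))
      rearrange = solve-∀
    rhs (suc k) = begin
      coeff (scale (ι (ℤ.- + c)) (twoT-1 *ₚ p₁)) (suc k)
        ≡⟨ coeff-scale (ι (ℤ.- + c)) (twoT-1 *ₚ p₁) (suc k) ⟩
      ι (ℤ.- + c) * coeff (twoT-1 *ₚ p₁) (suc k)
        ≡⟨ cong (ι (ℤ.- + c) *_) (coeff-twoT-1*-suc p₁ k) ⟩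
      ι (ℤ.- + c) * (ι (ℤ.- + 1) * coeff p₁ (suc k) + ι (+ 2) * coeff p₁ k)
        ≡⟨ cong₂ (λ x y → ι (ℤ.- + c) * (ι (ℤ.- + 1) * x + ι (+ 2) * y)) (h₁ (suc k)) (h₁ k) ⟩
      ι (ℤ.- + c) * (ι (ℤ.- + 1) * ι (alternating a₁ (suc k)) + ι (+ 2) * ι (alternating a₁ k))
        ≡⟨ trans (cong (ι (ℤ.- + c) *_) (ι-linear (ℤ.- + 1) (alternating a₁ (suc k)) (+ 2) (alternating a₁ k)))
                 (ι-* (ℤ.- + c) _) ⟩
      ι (ℤ.- + c ℤ.* (ℤ.- + 1 ℤ.* (ℤ.- sgn k ℤ.* + a₁ (suc k)) ℤ.+ + 2 ℤ.* (sgn k ℤ.* + a₁ k)))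
        ≡⟨ cong ι (rearrange (sgn k) (+ c) (+ a₁ (suc k)) (+ a₁ k)) ⟩
      ι (ℤ.- sgn k ℤ.* (+ c ℤ.* (+ a₁ (suc k) ℤ.+ + 2 ℤ.* + a₁ k)))
        ≡⟨ cong (λ x → ι (ℤ.- sgn k ℤ.* (+ c ℤ.* x))) (cast (a₁ (suc k)) (a₁ k)) ⟨
      ι (ℤ.- sgn k ℤ.* (+ c ℤ.* + (a₁ (suc k) ℕ.+ 2 ℕ.* a₁ k))) ∎
      where
      rearrange : ∀ s c a a′ → ℤ.- c ℤ.* (ℤ.- + 1 ℤ.* (ℤ.- s ℤ.* a) ℤ.+ + 2 ℤ.* (s ℤ.* a′))
                               ≡ ℤ.- s ℤ.* (c ℤ.* (a ℤ.+ + 2 ℤ.* a′))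
      rearrange = solve-∀

module ClusterPolynomials where

  open import Data.Nat as ℕ using (ℕ; zero; suc; _+_; _*_)
  import Data.Nat.Properties as ℕ
  open import Data.Integer as ℤ using (+_)
  import Data.Integer.Properties as ℤ
  open import Data.Rational as ℚ using (0ℚ; _/_)
  import Data.Rational.Properties as ℚ
  open import Data.Product using (_,_)
  open import Function using (_∘_)
  open import Function.Bundles using (_⇔_; mk⇔)
  open import Function.Construct.Composition using (_⇔-∘_)
  open import Function.Construct.Symmetry using (⇔-sym)
  open import Relation.Binary.PropositionalEquality
  open import Relation.Nullary using (¬_; contradiction)
  open CoefficientRecurrences
  open RationalPolynomials

  fB-coeffs : ∀ l → fB l HasCoeffs alternating (bB l)
  fB-coeffs l = coeff-map-applyUpTo (λ k → ι (alternating (bB l) k)) (λ k → k) (suc l) vanish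
    where
    vanish : ∀ k → suc l ℕ.≤ k → ι (alternating (bB l) k) ≡ 0ℚ
    vanish k l<k = trans (cong (λ x → ι (sgn k ℤ.* + x)) (bB-vanishes l<k)) (cong ι (ℤ.*-zeroʳ (sgn k)))

  scaledFA : ℕ → Poly
  scaledFA l = scale (ι (+ (2 + l))) (fA l)

  scaledFA-coeffs : ∀ l → scaledFA l HasCoeffs alternating (bA l)
  scaledFA-coeffs l k = begin
    coeff (scaledFA l) k                                  ≡⟨ coeff-scale (ι (+ (2 + l))) (fA l) k ⟩
    ι (+ (2 + l)) ℚ.* coeff (fA l) k
      ≡⟨ cong (ι (+ (2 + l)) ℚ.*_) (coeff-map-applyUpTo (λ k → alternating (bA l) k / (2 + l)) (λ k → k) (suc l) vanish k) ⟩
    ι (+ (2 + l)) ℚ.* (alternating (bA l) k / (2 + l))    ≡⟨ ι-*-/ (suc l) (alternating (bA l) k) ⟩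
    ι (alternating (bA l) k)                              ∎
    where
    open ≡-Reasoning
    vanish : ∀ k → suc l ℕ.≤ k → alternating (bA l) k / (2 + l) ≡ 0ℚ
    vanish k l<k = trans (cong (λ x → (sgn k ℤ.* + x) / (2 + l)) (bA-vanishes l<k))
      (trans (cong (_/ (2 + l)) (ℤ.*-zeroʳ (sgn k))) (ℚ.0/n≡0 (2 + l)))

  fB-recurrence : ∀ m →
    (scale (ι (+ (2 + m))) (fB (2 + m)) +ₚ scale (ι (+ (1 + m))) (fB m))
      ≈ₚ scale (ι (ℤ.- + (3 + 2 * m))) (twoT-1 *ₚ fB (1 + m))
  fB-recurrence m = alternating-recurrence (2 + m) (1 + m) (3 + 2 * m) (fB (2 + m)) (fB m) (fB (1 + m))
    (fB-coeffs (2 + m)) (fB-coeffs m) (fB-coeffs (1 + m)) (B-recurrence m)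

  scaledFA-recurrence : ∀ m →
    (scale (ι (+ ((2 + m) * (3 + m)))) (scaledFA (2 + m)) +ₚ scale (ι (+ ((1 + m) * (3 + m)))) (scaledFA m))
      ≈ₚ scale (ι (ℤ.- + ((5 + 2 * m) * (2 + m)))) (twoT-1 *ₚ scaledFA (1 + m))
  scaledFA-recurrence m =
    alternating-recurrence ((2 + m) * (3 + m)) ((1 + m) * (3 + m)) ((5 + 2 * m) * (2 + m))
      (scaledFA (2 + m)) (scaledFA m) (scaledFA (1 + m))
      (scaledFA-coeffs (2 + m)) (scaledFA-coeffs m) (scaledFA-coeffs (1 + m)) (A-recurrence m)

  fB-zeros-step : ∀ m → ev½ (fB (2 + m)) ≡ 0ℚ ⇔ ev½ (fB m) ≡ 0ℚ
  fB-zeros-step m = positive-combination-zeros (2 + m) (1 + m) (ev½ (fB (2 + m))) (ev½ (fB m))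
    (ev½-recurrence (ι (+ (2 + m))) (ι (+ (1 + m))) (ι (ℤ.- + (3 + 2 * m)))
                    (fB (2 + m)) (fB m) (fB (1 + m)) (fB-recurrence m))

  scaledFA-zeros-step : ∀ m → ev½ (scaledFA (2 + m)) ≡ 0ℚ ⇔ ev½ (scaledFA m) ≡ 0ℚ
  scaledFA-zeros-step m =
    positive-combination-zeros ((2 + m) * (3 + m)) ((1 + m) * (3 + m)) (ev½ (scaledFA (2 + m))) (ev½ (scaledFA m))
      (ev½-recurrence (ι (+ ((2 + m) * (3 + m)))) (ι (+ ((1 + m) * (3 + m)))) (ι (ℤ.- + ((5 + 2 * m) * (2 + m))))
                      (scaledFA (2 + m)) (scaledFA m) (scaledFA (1 + m)) (scaledFA-recurrence m))

  ev½-scaledFA≡0⇔ev½-fA≡0 : ∀ l → ev½ (scaledFA l) ≡ 0ℚ ⇔ ev½ (fA l) ≡ 0ℚ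
  ev½-scaledFA≡0⇔ev½-fA≡0 l = ι*≡0⇔≡0 (2 + l) (ev½ (fA l)) ⇔-∘ mk⇔ (trans (sym scaled)) (trans scaled)
    where
    scaled : ev½ (scaledFA l) ≡ ι (+ (2 + l)) ℚ.* ev½ (fA l)
    scaled = ev½-scale (ι (+ (2 + l))) (fA l)

  Odd-2+ : ∀ l → Odd (2 + l) ⇔ Odd l
  Odd-2+ l = mk⇔ down up
    where
    down : Odd (2 + l) → Odd l
    down (zero  , ())
    down (suc m , eq) = m , ℕ.suc-injective (ℕ.suc-injective (trans eq (cong suc (ℕ.*-suc 2 m))))
    up : Odd l → Odd (2 + l)
    up (m , eq) = suc m , trans (cong (λ n → 2 + n) eq) (cong suc (sym (ℕ.*-suc 2 m)))

  zeros-at-odd : ∀ (v : ℕ → ℚ.ℚ) → ¬ v 0 ≡ 0ℚ → v 1 ≡ 0ℚ → (∀ l → v (2 + l) ≡ 0ℚ ⇔ v l ≡ 0ℚ) →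
    ∀ l → v l ≡ 0ℚ ⇔ Odd l
  zeros-at-odd v v0≢0 v1≡0 step zero          = mk⇔ (λ v0≡0 → contradiction v0≡0 v0≢0) λ { (m , ()) }
  zeros-at-odd v v0≢0 v1≡0 step (suc zero)    = mk⇔ (λ _ → 0 , refl) (λ _ → v1≡0)
  zeros-at-odd v v0≢0 v1≡0 step (suc (suc l)) =
    ⇔-sym (Odd-2+ l) ⇔-∘ (zeros-at-odd v v0≢0 v1≡0 step l ⇔-∘ step l)

  twoT-1∣fB⇔Odd : ∀ l → twoT-1 ∣ₚ fB l ⇔ Odd l
  twoT-1∣fB⇔Odd l = zeros-at-odd (ev½ ∘ fB) (λ ()) refl fB-zeros-step l ⇔-∘ twoT-1∣⇔ev½≡0 (fB l)

  twoT-1∣fA⇔Odd : ∀ l → twoT-1 ∣ₚ fA l ⇔ Odd l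
  twoT-1∣fA⇔Odd l =
    zeros-at-odd (ev½ ∘ scaledFA) (λ ()) refl scaledFA-zeros-step l
      ⇔-∘ (⇔-sym (ev½-scaledFA≡0⇔ev½-fA≡0 l) ⇔-∘ twoT-1∣⇔ev½≡0 (fA l))

open ClusterPolynomials using (twoT-1∣fA⇔Odd; twoT-1∣fB⇔Odd)

corollary3p2 : ((l : ℕ) → 1 ≤ l → (twoT-1 ∣ₚ fA l) ⇔ Odd l)
               × ((l : ℕ) → 2 ≤ l → (twoT-1 ∣ₚ fB l) ⇔ Odd l)
corollary3p2 = (λ l _ → twoT-1∣fA⇔Odd l) , (λ l _ → twoT-1∣fB⇔Odd l)
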